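{- Let $\phi : H \rightarrow G$ be a complete graph homomorphism between finite graphs, let $n$ be a positive integer with $\chi(H) \leq n$, and fix any identification of $V(G)$ with $\{1,\dots,|V(G)|\}$. Then there is a $(G,n,\mathcal F_{G,\phi})$-independent system (with respect to this identification).
   Context: Graphs are simple; $N(v)$ denotes the set of neighbours of $v$, and $\phi(X)=\{\phi(x):x\in X\}$. A homomorphism $\phi:H\to G$ is complete if for any $x,z\in V(H)$ with $\phi(z)\in\phi(N(x))$ and $\phi(x)\in\phi(N(z))$ we have $(x,z)\in E(H)$. $\mathcal F_{G,\phi} = \{(\phi(v), \phi(N(v))) : v \in V(H)\}$. For $G$ with vertices identified with $\{1,\dots,|V(G)|\}$, a positive integer $n$, and a collection $\mathcal F_G$ of pairs $(v,S)$ with $v\in V(G)$ and $S$ a set of neighbours of $v$, a family $\{A_{u,v}\}$ indexed by edges $(u,v)\in E(G)$ with $u<v$, each $A_{u,v}\subseteq[n]$, is $(G,n,\mathcal F_G)$-independent if for every $(v,S)\in\mathcal F_G$: if $v>\min S$ then $\bigcap_{u\in S,\,u<v}A_{u,v}\setminus\bigcup_{w\in S,\,w>v}A_{v,w}\neq\emptyset$, and if $v<\min S$ (or $S=\emptyset$) then $[n]\setminus\bigcup_{w\in S,\,w>v}A_{v,w}\neq\emptyset$. -}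

module Defs where

open import Data.Nat using (ℕ)
open import Data.Bool using (Bool; true)
open import Data.Fin using (Fin; _<_)
open import Data.Fin.Subset using (Subset; _∈_; _∉_)
open import Data.Product using (Σ; ∃; _×_)
open import Relation.Binary.PropositionalEquality using (_≡_)
open import Relation.Nullary using (¬_)

-- A finite simple graph on vertex set Fin k (vertices identified with
-- {1,…,k} via Fin's order): Boolean adjacency, symmetric, irreflexive.
record Graph (k : ℕ) : Set where
  field
    adj     : Fin k → Fin k → Bool
    adj-sym : ∀ x y → adj x y ≡ adj y x
    adj-irr : ∀ x → ¬ (adj x x ≡ true)

open Graph public

Edge : ∀ {k} → Graph k → Fin k → Fin k → Set
Edge G x y = adj G x y ≡ true

IsHom : ∀ {h g} → Graph h → Graph g → (Fin h → Fin g) → Set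
IsHom H G φ = ∀ x y → Edge H x y → Edge G (φ x) (φ y)

InImageNbhd : ∀ {h g} → Graph h → (Fin h → Fin g) → Fin h → Fin g → Set
InImageNbhd H φ x u = ∃ λ y → Edge H x y × φ y ≡ u

IsComplete : ∀ {h g} → Graph h → (Fin h → Fin g) → Set
IsComplete H φ = ∀ x z → InImageNbhd H φ x (φ z) → InImageNbhd H φ z (φ x) → Edge H x z

ChromaticAtMost : ∀ {h} → Graph h → ℕ → Set
ChromaticAtMost {h} H n = Σ (Fin h → Fin n) λ c → ∀ x y → Edge H x y → ¬ (c x ≡ c y)

-- A family {A_{u,v}} of subsets of [n]; only its values on edges (u,v) of G
-- with u < v are ever used.
Family : ℕ → ℕ → Set
Family g n = Fin g → Fin g → Subset n

PairCondition : ∀ {g n} → Graph g → Family g n → Fin g → (Fin g → Set) → Set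
PairCondition {g} {n} G A v S =
    ((∃ λ u → S u × u < v) →
       ∃ λ c → (∀ u → S u → u < v → c ∈ A u v) × (∀ w → S w → v < w → c ∉ A v w))
  × ((∀ u → S u → v < u) →
       ∃ λ c → (∀ w → S w → v < w → c ∉ A v w))

-- (G, n, F_{G,φ})-independence, where F_{G,φ} = {(φ(x), φ(N(x))) : x ∈ V(H)}
IndependentFor : ∀ {h g} → Graph h → Graph g → (Fin h → Fin g) → (n : ℕ) → Family g n → Set
IndependentFor H G φ n A = ∀ x → PairCondition G A (φ x) (InImageNbhd H φ x)

-- Properly colour H with n colours by c, and let A_{u,v} be the set of colours c(y) of
-- the vertices y with φ(y) = v and u ∈ φ(N(y)). For the pair (φ(x), φ(N(x))) the colour
-- c(x) is then a common witness, regardless of the order of the vertices: it lies in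
-- every A_{u,φ(x)} with u ∈ φ(N(x)) (take y = x), and it lies in no A_{φ(x),w} with
-- w ∈ φ(N(x)), since a vertex y with φ(y) = w, φ(x) ∈ φ(N(y)) and c(y) = c(x) would be
-- adjacent to x by completeness, contradicting properness of c.
module Submission where

open import Defs
open import Data.Nat using (ℕ; _≤_)
open import Data.Bool using (true) renaming (_≟_ to _≟ᴮ_)
open import Data.Bool.Properties using (T-≡)
open import Data.Fin using (Fin; _≟_)
open import Data.Fin.Properties using (any?)
open import Data.Fin.Subset using (Subset; _∈_; _∉_)
open import Data.Product using (∃; _×_; _,_)
open import Data.Vec using (tabulate)
open import Data.Vec.Properties using (lookup∘tabulate; lookup⇒[]=; []=⇒lookup)
open import Function using (_∘_; Equivalence)
open import Relation.Nullary using (¬_)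
open import Relation.Nullary.Decidable using (isYes; _×-dec_; toWitness; fromWitness)
open import Relation.Unary using (Pred; Decidable)
open import Relation.Binary.PropositionalEquality using (_≡_; refl; sym; trans)

subset : ∀ {n p} {P : Pred (Fin n) p} → Decidable P → Subset n
subset P? = tabulate (isYes ∘ P?)

module _ {n p} {P : Pred (Fin n) p} (P? : Decidable P) where

  ∈-subset⁺ : ∀ {i} → P i → i ∈ subset P?
  ∈-subset⁺ {i} Pi = lookup⇒[]= i (subset P?)
    (trans (lookup∘tabulate (isYes ∘ P?) i) (Equivalence.to T-≡ (fromWitness {a? = P? i} Pi)))

  ∈-subset⁻ : ∀ {i} → i ∈ subset P? → P i
  ∈-subset⁻ {i} i∈ = toWitness {a? = P? i} (Equivalence.from T-≡
    (trans (sym (lookup∘tabulate (isYes ∘ P?) i)) ([]=⇒lookup i∈)))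

PairCondition-byWitness : ∀ {g n} (G : Graph g) (A : Family g n) v (S : Fin g → Set) (k : Fin n) →
  (∀ u → S u → k ∈ A u v) → (∀ w → S w → k ∉ A v w) → PairCondition G A v S
PairCondition-byWitness G A v S k k∈ k∉ =
    (λ _ → k , (λ u Su _ → k∈ u Su) , (λ w Sw _ → k∉ w Sw))
  , (λ _ → k , (λ w Sw _ → k∉ w Sw))

inImageNbhd? : ∀ {h g} (H : Graph h) (φ : Fin h → Fin g) x → Decidable (InImageNbhd H φ x)
inImageNbhd? H φ x u = any? λ y → (adj H x y ≟ᴮ true) ×-dec (φ y ≟ u)

IsProperColouring : ∀ {h n} → Graph h → (Fin h → Fin n) → Set
IsProperColouring H c = ∀ x y → Edge H x y → ¬ (c x ≡ c y)

module ColourFamily {h g n} (H : Graph h) (φ : Fin h → Fin g) (c : Fin h → Fin n) where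

  ColourOver : Fin g → Fin g → Pred (Fin n) _
  ColourOver u v k = ∃ λ y → φ y ≡ v × InImageNbhd H φ y u × c y ≡ k

  colourOver? : ∀ u v → Decidable (ColourOver u v)
  colourOver? u v k =
    any? λ y → (φ y ≟ v) ×-dec inImageNbhd? H φ y u ×-dec (c y ≟ k)

  colourFamily : Family g n
  colourFamily u v = subset (colourOver? u v)

  ownColour-∈ : ∀ x u → InImageNbhd H φ x u → c x ∈ colourFamily u (φ x)
  ownColour-∈ x u u∈ = ∈-subset⁺ (colourOver? u (φ x)) (x , refl , u∈ , refl)

  ownColour-∉ : IsComplete H φ → IsProperColouring H c →
                ∀ x w → InImageNbhd H φ x w → c x ∉ colourFamily (φ x) w
  ownColour-∉ complete proper x w w∈ cx∈ with ∈-subset⁻ (colourOver? (φ x) w) cx∈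
  ... | y , refl , φx∈ , cy≡cx = proper x y (complete x y w∈ φx∈) (sym cy≡cx)

lemma2p3 : ∀ {h g} (H : Graph h) (G : Graph g) (φ : Fin h → Fin g) (n : ℕ) →
    IsHom H G φ → IsComplete H φ → 1 ≤ n → ChromaticAtMost H n →
    ∃ λ (A : Family g n) → IndependentFor H G φ n A
lemma2p3 H G φ n _ complete _ (c , proper) = colourFamily , λ x →
  PairCondition-byWitness G colourFamily (φ x) (InImageNbhd H φ x) (c x)
    (ownColour-∈ x) (ownColour-∉ complete proper x)
  where open ColourFamily H φ c
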